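{- Let $\mathbf{d}=(d_1,\dots,d_n)$ be a graphical sequence with $n>2$. If $\mathbf{d}$ admits a realization with two spanning trees that share at most one edge, then $\sum_{i=1}^n d_i\ge 4(n-1)-2$, $d_{n-1}\ge 2$, and $d_n\ge 1$.
   Context: A degree sequence is non-increasing, $d_1\ge\dots\ge d_n\ge 0$; it is graphical if some simple graph on $v_1,\dots,v_n$ has $\deg(v_i)=d_i$ (a realization). Two spanning trees share at most one edge if their edge sets have at most one common element. -}

module Defs where

import Data.Nat
open import Data.Nat using (ℕ; zero; suc; _+_; _*_; _∸_; _≤_; _<_)
open import Data.Fin using (Fin; toℕ)
open import Data.Bool using (Bool; true; false; _∧_)
open import Data.List using (List; []; _∷_; length; filter; map)
open import Data.Nat.ListAction using (sum)
open import Data.List.Relation.Unary.Linked using (Linked)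
open import Data.Vec.Functional using (Vector)
open import Data.Product using (Σ; _×_; _,_; ∃)
open import Relation.Binary.PropositionalEquality using (_≡_; _≢_)
open import Relation.Nullary using (¬_)
open import Data.Fin.Properties using (_<?_)
open import Data.List using (allFin)
open import Relation.Nullary.Decidable using (⌊_⌋)
open import Data.Bool using (T)

record Graph (n : ℕ) : Set where
  field
    adj  : Fin n → Fin n → Bool
    sym  : ∀ i j → adj i j ≡ adj j i
    irr  : ∀ i → adj i i ≡ false
open Graph public

deg : ∀ {n} → Graph n → Fin n → ℕ
deg G i = length (filter (λ j → T? (adj G i j)) (allFin _))
  where
  open import Data.Bool.Properties using () renaming (T? to T?)

Realizes : ∀ {n} → Graph n → Vector ℕ n → Set
Realizes G d = ∀ i → deg G i ≡ d i

NonIncreasing : ∀ {n} → Vector ℕ n → Set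
NonIncreasing {n} d = ∀ (i j : Fin n) → toℕ i ≤ toℕ j → d j ≤ d i

Graphical : ∀ {n} → Vector ℕ n → Set
Graphical {n} d = NonIncreasing d × Σ (Graph n) (λ G → Realizes G d)

sumV : ∀ {n} → Vector ℕ n → ℕ
sumV d = sum (map d (allFin _))

data Walk {n : ℕ} (H : Graph n) : Fin n → Fin n → Set where
  here : ∀ {u} → Walk H u u
  step : ∀ {u w v} → T (adj H u w) → Walk H w v → Walk H u v

Connected : ∀ {n} → Graph n → Set
Connected {n} H = ∀ (u v : Fin n) → Walk H u v

_⊆G_ : ∀ {n} → Graph n → Graph n → Set
H ⊆G G = ∀ i j → T (adj H i j) → T (adj G i j)

removeEdge : ∀ {n} → Graph n → Fin n → Fin n → Graph n
removeEdge {n} H a b = record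
  { adj = λ i j → adj H i j ∧ not (same i j)
  ; sym = λ i j → cong₂ _∧_ (Graph.sym H i j) (cong not (same-sym i j))
  ; irr = λ i → cong (_∧ _) (Graph.irr H i)
  }
  where
  open import Data.Bool using (not; _∨_)
  open import Relation.Binary.PropositionalEquality using (cong; cong₂)
  open import Data.Fin using (_≟_)
  open import Data.Bool.Properties using (∨-comm)
  same : Fin n → Fin n → Bool
  same i j = (⌊ i ≟ a ⌋ ∧ ⌊ j ≟ b ⌋) ∨ (⌊ i ≟ b ⌋ ∧ ⌊ j ≟ a ⌋)
  same-sym : ∀ i j → same i j ≡ same j i
  same-sym i j rewrite Data.Bool.Properties.∧-comm ⌊ i ≟ a ⌋ ⌊ j ≟ b ⌋
                     | Data.Bool.Properties.∧-comm ⌊ i ≟ b ⌋ ⌊ j ≟ a ⌋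
    = ∨-comm (⌊ j ≟ b ⌋ ∧ ⌊ i ≟ a ⌋) (⌊ j ≟ a ⌋ ∧ ⌊ i ≟ b ⌋)
    where import Data.Bool.Properties

-- Acyclic: every edge is a bridge, i.e. after deleting edge {a,b}
-- there is no walk from a to b (equivalently, no cycle).
Acyclic : ∀ {n} → Graph n → Set
Acyclic {n} H = ∀ (a b : Fin n) → T (adj H a b) → ¬ Walk (removeEdge H a b) a b

SpanningTree : ∀ {n} → Graph n → Graph n → Set
SpanningTree G H = (H ⊆G G) × Connected H × Acyclic H

commonEdges : ∀ {n} → Graph n → Graph n → ℕ
commonEdges {n} H₁ H₂ =
  sum (map (λ i → length (filter (λ j → ((i <? j) ×-dec T? (adj H₁ i j ∧ adj H₂ i j))) (allFin n))) (allFin n))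
  where
  open import Data.Bool.Properties using (T?)
  open import Relation.Nullary.Decidable using (_×-dec_)

-- index bounds for d_{n-1} (0-based index n-2) and d_n (0-based index n-1)
∸-lemma₁ : ∀ n → 2 < n → n ∸ 1 < n
∸-lemma₁ (suc n) _ = Data.Nat.Properties.n<1+n n
  where import Data.Nat.Properties

∸-lemma₂ : ∀ n → 2 < n → n ∸ 2 < n
∸-lemma₂ (suc zero) (Data.Nat.s≤s ())
∸-lemma₂ (suc (suc n)) _ = Data.Nat.Properties.m≤n⇒m≤1+n (Data.Nat.Properties.n<1+n n)
  where import Data.Nat.Properties

-- A connected graph on n vertices has at least n − 1 edges: orient each non-root vertex
-- towards a neighbour strictly closer to the root (breadth-first levels); these n − 1
-- ordered adjacent pairs and their reverses are all distinct.  Two connected spanning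
-- subgraphs of G sharing at most one edge therefore give G at least 2(n − 1) − 1 edges,
-- i.e. degree sum at least 4(n − 1) − 2.
-- Every vertex has a tree neighbour, so d_n ≥ 1.  If d_{n−1} ≤ 1, the last two vertices
-- are pendant in G and the unique edge at a pendant vertex lies in both trees: either the
-- two pendant edges are distinct shared edges, or they coincide and the two vertices
-- form a component of G that no spanning tree joins to the remaining vertices.
module Submission where

open import Defs hiding (sym)
open import Data.Nat using (ℕ; zero; suc; _+_; _*_; _∸_; _≤_; _<_; z≤n; s≤s; z<s)
open import Data.Nat.Properties
  using ( ≤-refl; ≤-trans; ≤-reflexive; <-asym; ≮⇒≥; 1+n≰n; n≤1+n; m≤m+n; m≤n+m; m≤n+o⇒m∸n≤o
        ; +-comm; +-assoc; +-identityʳ; +-mono-≤; +-monoˡ-≤; +-monoʳ-≤; *-monoʳ-≤; *-distribʳ-+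
        ; +-*-semiring; module ≤-Reasoning )
open import Data.Fin using (Fin; zero; suc; toℕ; fromℕ<; _≟_; _<?_) renaming (_<_ to _<ᶠ_)
open import Data.Fin.Properties using (any?; <-cmp; <-irrefl; toℕ-fromℕ<; fromℕ<-injective)
open import Data.Bool using (Bool; true; false; _∧_; _∨_; T)
open import Data.Bool.Properties using (T?; T-∧; T-∨)
open import Data.List using (length; filter; map; tabulate; allFin)
open import Data.List.Properties using (map-tabulate)
import Data.Nat.ListAction as List
open import Data.Vec.Functional using (Vector)
open import Data.Product using (Σ; ∃-syntax; _×_; _,_; proj₁; proj₂)
open import Data.Sum using (_⊎_; inj₁; inj₂; [_,_]′)
open import Data.Empty using (⊥)
open import Function using (_∘_; id; Equivalence)
open import Level using (0ℓ)
open import Relation.Binary using (tri<; tri≈; tri>)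
open import Relation.Binary.PropositionalEquality
open import Relation.Nullary using (does; yes; no; contradiction)
open import Relation.Nullary.Decidable using (_×-dec_; _⊎-dec_; dec-true; dec-false)
open import Relation.Unary using (Pred; Decidable)
open import Algebra.Properties.Semiring.Sum +-*-semiring
  using (sum-syntax; sum-cong-≗; ∑-distrib-+; ∑-comm; sum-replicate-zero)

open Equivalence using (to; from)

𝟙 : Bool → ℕ
𝟙 true  = 1
𝟙 false = 0

1≤𝟙 : ∀ {a} → T a → 1 ≤ 𝟙 a
1≤𝟙 {true} _ = ≤-refl

𝟙-mono : ∀ {a b} → (T a → T b) → 𝟙 a ≤ 𝟙 b
𝟙-mono {false} _ = z≤n
𝟙-mono {true}  a⇒b = 1≤𝟙 (a⇒b _)

𝟙-∨-∧ : ∀ a b → 𝟙 a + 𝟙 b ≡ 𝟙 (a ∨ b) + 𝟙 (a ∧ b)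
𝟙-∨-∧ true  true  = refl
𝟙-∨-∧ true  false = refl
𝟙-∨-∧ false true  = refl
𝟙-∨-∧ false false = refl

𝟙-disjoint : ∀ {a b c} → (T a → T c) → (T b → T c) → (T a → T b → ⊥) → 𝟙 a + 𝟙 b ≤ 𝟙 c
𝟙-disjoint {false}        _   b⇒c _    = 𝟙-mono b⇒c
𝟙-disjoint {true} {false} a⇒c _   _    = 𝟙-mono a⇒c
𝟙-disjoint {true} {true}  _   _   a⇒¬b = contradiction _ (a⇒¬b _)

T-does-≟ : ∀ {n} (u w : Fin n) → T (does (u ≟ w)) → u ≡ w
T-does-≟ u w t with u ≟ w
... | yes u≡w = u≡w

∑-mono-≤ : ∀ {n} {f g : Vector ℕ n} → (∀ i → f i ≤ g i) → ∑[ i < n ] f i ≤ ∑[ i < n ] g i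
∑-mono-≤ {zero}  _   = z≤n
∑-mono-≤ {suc n} f≤g = +-mono-≤ (f≤g zero) (∑-mono-≤ (f≤g ∘ suc))

∑-const-1 : ∀ n → ∑[ i < n ] 1 ≡ n
∑-const-1 zero    = refl
∑-const-1 (suc n) = cong suc (∑-const-1 n)

∑-𝟙-≟ : ∀ {n} (w : Fin n) → ∑[ u < n ] 𝟙 (does (u ≟ w)) ≡ 1
∑-𝟙-≟ {suc n} zero    = cong suc (sum-replicate-zero n)
∑-𝟙-≟ {suc n} (suc w) = ∑-𝟙-≟ w

∑-point : ∀ {n} (f : Vector ℕ n) x → f x ≤ ∑[ i < n ] f i
∑-point f zero    = m≤m+n _ _
∑-point f (suc x) = ≤-trans (∑-point (f ∘ suc) x) (m≤n+m _ (f zero))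

∑-pair : ∀ {n} (f : Vector ℕ n) {x y} → x ≢ y → f x + f y ≤ ∑[ i < n ] f i
∑-pair f {zero}  {zero}  x≢y = contradiction refl x≢y
∑-pair f {zero}  {suc y} _   = +-monoʳ-≤ (f zero) (∑-point (f ∘ suc) y)
∑-pair f {suc x} {zero}  _   = begin
  f (suc x) + f zero ≡⟨ +-comm (f (suc x)) (f zero) ⟩
  f zero + f (suc x) ≤⟨ +-monoʳ-≤ (f zero) (∑-point (f ∘ suc) x) ⟩
  ∑[ i < _ ] f i     ∎
  where open ≤-Reasoning
∑-pair f {suc x} {suc y} x≢y = ≤-trans (∑-pair (f ∘ suc) (x≢y ∘ cong suc)) (m≤n+m _ (f zero))

∑-triple : ∀ {n} (f : Vector ℕ n) {x y z} → x ≢ y → x ≢ z → y ≢ z →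
           f x + f y + f z ≤ ∑[ i < n ] f i
∑-triple f {zero}  {zero}          x≢y _   _   = contradiction refl x≢y
∑-triple f {zero}  {suc _} {zero}  _   x≢z _   = contradiction refl x≢z
∑-triple f {suc _} {zero}  {zero}  _   _   y≢z = contradiction refl y≢z
∑-triple f {zero}  {suc y} {suc z} _   _   y≢z = begin
  f zero + f (suc y) + f (suc z)   ≡⟨ +-assoc (f zero) _ _ ⟩
  f zero + (f (suc y) + f (suc z)) ≤⟨ +-monoʳ-≤ (f zero) (∑-pair (f ∘ suc) (y≢z ∘ cong suc)) ⟩
  ∑[ i < _ ] f i                   ∎
  where open ≤-Reasoning
∑-triple f {suc x} {zero}  {suc z} _   x≢z _   = begin
  f (suc x) + f zero + f (suc z)   ≡⟨ cong (_+ f (suc z)) (+-comm (f (suc x)) (f zero)) ⟩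
  f zero + f (suc x) + f (suc z)   ≡⟨ +-assoc (f zero) _ _ ⟩
  f zero + (f (suc x) + f (suc z)) ≤⟨ +-monoʳ-≤ (f zero) (∑-pair (f ∘ suc) (x≢z ∘ cong suc)) ⟩
  ∑[ i < _ ] f i                   ∎
  where open ≤-Reasoning
∑-triple f {suc x} {suc y} {zero}  x≢y _   _   = begin
  f (suc x) + f (suc y) + f zero   ≡⟨ +-comm (f (suc x) + f (suc y)) (f zero) ⟩
  f zero + (f (suc x) + f (suc y)) ≤⟨ +-monoʳ-≤ (f zero) (∑-pair (f ∘ suc) (x≢y ∘ cong suc)) ⟩
  ∑[ i < _ ] f i                   ∎
  where open ≤-Reasoning
∑-triple f {suc x} {suc y} {suc z} x≢y x≢z y≢z =
  ≤-trans (∑-triple (f ∘ suc) (x≢y ∘ cong suc) (x≢z ∘ cong suc) (y≢z ∘ cong suc)) (m≤n+m _ (f zero))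

sum-map-allFin : ∀ {n} (f : Vector ℕ n) → List.sum (map f (allFin n)) ≡ ∑[ i < n ] f i
sum-map-allFin f = trans (cong List.sum (map-tabulate id f)) (sum-tabulate f)
  where
  sum-tabulate : ∀ {n} (f : Vector ℕ n) → List.sum (tabulate f) ≡ ∑[ i < n ] f i
  sum-tabulate {zero}  f = refl
  sum-tabulate {suc n} f = cong (f zero +_) (sum-tabulate (f ∘ suc))

length-filter-allFin : ∀ {n} {P : Pred (Fin n) 0ℓ} (P? : Decidable P) →
                       length (filter P? (allFin n)) ≡ ∑[ i < n ] 𝟙 (does (P? i))
length-filter-allFin P? = length-filter-tabulate P? id
  where
  length-filter-tabulate : ∀ {A : Set} {P : Pred A 0ℓ} (P? : Decidable P) {n} (f : Fin n → A) →
                           length (filter P? (tabulate f)) ≡ ∑[ i < n ] 𝟙 (does (P? (f i)))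
  length-filter-tabulate P? {zero}  f = refl
  length-filter-tabulate P? {suc n} f with does (P? (f zero))
  ... | true  = cong suc (length-filter-tabulate P? (f ∘ suc))
  ... | false = length-filter-tabulate P? (f ∘ suc)

least-witness : ∀ {P : Pred ℕ 0ℓ} → Decidable P → ∀ {k} → P k →
                ∃[ l ] P l × (∀ {j} → P j → l ≤ j)
least-witness P? {zero} Pk = 0 , Pk , λ _ → z≤n
least-witness {P} P? {suc k} Pk with P? 0
... | yes P0 = 0 , P0 , λ _ → z≤n
... | no ¬P0 with least-witness (P? ∘ suc) Pk
...   | l , Pl , minimal = suc l , Pl , minimal′
  where
  minimal′ : ∀ {j} → P j → suc l ≤ j
  minimal′ {zero}  P0 = contradiction P0 ¬P0
  minimal′ {suc j} Pj = s≤s (minimal Pj)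

module _ {n : ℕ} where

  _∩G_ : Graph n → Graph n → Graph n
  H₁ ∩G H₂ = record
    { adj = λ i j → adj H₁ i j ∧ adj H₂ i j
    ; sym = λ i j → cong₂ _∧_ (Graph.sym H₁ i j) (Graph.sym H₂ i j)
    ; irr = λ i → cong (_∧ adj H₂ i i) (irr H₁ i)
    }

  degreeSum : Graph n → ℕ
  degreeSum H = ∑[ v < n ] deg H v

  edgeCount : Graph n → ℕ
  edgeCount H = ∑[ i < n ] ∑[ j < n ] 𝟙 (does (i <? j) ∧ adj H i j)

  deg≡∑ : ∀ (H : Graph n) v → deg H v ≡ ∑[ u < n ] 𝟙 (adj H v u)
  deg≡∑ H v = length-filter-allFin (T? ∘ adj H v)

  degreeSum≡∑∑ : ∀ (H : Graph n) → degreeSum H ≡ ∑[ v < n ] ∑[ u < n ] 𝟙 (adj H v u)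
  degreeSum≡∑∑ H = sum-cong-≗ (deg≡∑ H)

  commonEdges≡edgeCount : ∀ (H₁ H₂ : Graph n) → commonEdges H₁ H₂ ≡ edgeCount (H₁ ∩G H₂)
  commonEdges≡edgeCount H₁ H₂ =
    trans (sum-map-allFin sharedAbove) (sum-cong-≗ λ i → length-filter-allFin (shared? i))
    where
    shared? : ∀ i → Decidable (λ j → i <ᶠ j × T (adj H₁ i j ∧ adj H₂ i j))
    shared? i j = (i <? j) ×-dec T? (adj H₁ i j ∧ adj H₂ i j)
    sharedAbove : Fin n → ℕ
    sharedAbove i = length (filter (shared? i) (allFin n))

  realizes⇒sumV≡degreeSum : ∀ (G : Graph n) {d : Vector ℕ n} → Realizes G d →
                            sumV d ≡ degreeSum G
  realizes⇒sumV≡degreeSum G {d} G⊨d = trans (sum-map-allFin d) (sum-cong-≗ (sym ∘ G⊨d))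

  handshake : ∀ (H : Graph n) → degreeSum H ≡ 2 * edgeCount H
  handshake H = begin
    degreeSum H
      ≡⟨ degreeSum≡∑∑ H ⟩
    ∑[ i < n ] ∑[ j < n ] 𝟙 (adj H i j)
      ≡⟨ sum-cong-≗ (λ i → sum-cong-≗ (split i)) ⟩
    ∑[ i < n ] ∑[ j < n ] (E i j + E j i)
      ≡⟨ sum-cong-≗ (λ i → ∑-distrib-+ (E i) (λ j → E j i)) ⟩
    ∑[ i < n ] (∑[ j < n ] E i j + ∑[ j < n ] E j i)
      ≡⟨ ∑-distrib-+ (λ i → ∑[ j < n ] E i j) _ ⟩
    edgeCount H + ∑[ i < n ] ∑[ j < n ] E j i
      ≡⟨ cong (edgeCount H +_) (∑-comm (λ i j → E j i)) ⟩
    edgeCount H + edgeCount H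
      ≡⟨ cong (edgeCount H +_) (+-identityʳ _) ⟨
    2 * edgeCount H
      ∎
    where
    open ≡-Reasoning
    E : Fin n → Fin n → ℕ
    E i j = 𝟙 (does (i <? j) ∧ adj H i j)
    split : ∀ i j → 𝟙 (adj H i j) ≡ E i j + E j i
    split i j with <-cmp i j
    ... | tri< i<j _ j≮i rewrite dec-true (i <? j) i<j | dec-false (j <? i) j≮i
      = sym (+-identityʳ _)
    ... | tri> i≮j _ j<i rewrite dec-false (i <? j) i≮j | dec-true (j <? i) j<i
      = cong 𝟙 (Graph.sym H i j)
    ... | tri≈ _ refl _  rewrite dec-false (i <? i) (<-irrefl refl) | irr H i
      = refl

  deg-inclusion-exclusion : ∀ {G H₁ H₂ : Graph n} → H₁ ⊆G G → H₂ ⊆G G →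
                            ∀ v → deg H₁ v + deg H₂ v ≤ deg G v + deg (H₁ ∩G H₂) v
  deg-inclusion-exclusion {G} {H₁} {H₂} H₁⊆G H₂⊆G v = begin
    deg H₁ v + deg H₂ v
      ≡⟨ cong₂ _+_ (deg≡∑ H₁ v) (deg≡∑ H₂ v) ⟩
    ∑[ u < n ] 𝟙 (a u) + ∑[ u < n ] 𝟙 (b u)
      ≡⟨ ∑-distrib-+ (𝟙 ∘ a) (𝟙 ∘ b) ⟨
    ∑[ u < n ] (𝟙 (a u) + 𝟙 (b u))
      ≡⟨ sum-cong-≗ (λ u → 𝟙-∨-∧ (a u) (b u)) ⟩
    ∑[ u < n ] (𝟙 (a u ∨ b u) + 𝟙 (a u ∧ b u))
      ≤⟨ ∑-mono-≤ (λ u → +-monoˡ-≤ (𝟙 (a u ∧ b u)) (𝟙-mono (∪⊆G u))) ⟩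
    ∑[ u < n ] (𝟙 (adj G v u) + 𝟙 (a u ∧ b u))
      ≡⟨ ∑-distrib-+ (𝟙 ∘ adj G v) _ ⟩
    ∑[ u < n ] 𝟙 (adj G v u) + ∑[ u < n ] 𝟙 (a u ∧ b u)
      ≡⟨ cong₂ _+_ (deg≡∑ G v) (deg≡∑ (H₁ ∩G H₂) v) ⟨
    deg G v + deg (H₁ ∩G H₂) v
      ∎
    where
    open ≤-Reasoning
    a b : Fin n → Bool
    a = adj H₁ v
    b = adj H₂ v
    ∪⊆G : ∀ u → T (a u ∨ b u) → T (adj G v u)
    ∪⊆G u t with to T-∨ t
    ... | inj₁ t₁ = H₁⊆G v u t₁
    ... | inj₂ t₂ = H₂⊆G v u t₂

  degreeSum-inclusion-exclusion : ∀ {G H₁ H₂ : Graph n} → H₁ ⊆G G → H₂ ⊆G G →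
                                  degreeSum H₁ + degreeSum H₂ ≤ degreeSum G + degreeSum (H₁ ∩G H₂)
  degreeSum-inclusion-exclusion {G} {H₁} {H₂} H₁⊆G H₂⊆G = begin
    degreeSum H₁ + degreeSum H₂
      ≡⟨ ∑-distrib-+ (deg H₁) (deg H₂) ⟨
    ∑[ v < n ] (deg H₁ v + deg H₂ v)
      ≤⟨ ∑-mono-≤ (deg-inclusion-exclusion {G} {H₁} {H₂} H₁⊆G H₂⊆G) ⟩
    ∑[ v < n ] (deg G v + deg (H₁ ∩G H₂) v)
      ≡⟨ ∑-distrib-+ (deg G) (deg (H₁ ∩G H₂)) ⟩
    degreeSum G + degreeSum (H₁ ∩G H₂)
      ∎
    where open ≤-Reasoning

  2*asymmetric≤degreeSum : ∀ (H : Graph n) (R : Fin n → Fin n → Bool) →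
                           (∀ v u → T (R v u) → T (adj H v u)) →
                           (∀ v u → T (R v u) → T (R u v) → ⊥) →
                           2 * ∑[ v < n ] ∑[ u < n ] 𝟙 (R v u) ≤ degreeSum H
  2*asymmetric≤degreeSum H R R⊆H asym = begin
    2 * ∑R
      ≡⟨ cong (∑R +_) (+-identityʳ ∑R) ⟩
    ∑R + ∑R
      ≡⟨ cong (∑R +_) (∑-comm (λ v u → 𝟙 (R v u))) ⟩
    ∑R + ∑[ u < n ] ∑[ v < n ] 𝟙 (R v u)
      ≡⟨ ∑-distrib-+ (λ v → ∑[ u < n ] 𝟙 (R v u)) _ ⟨
    ∑[ v < n ] (∑[ u < n ] 𝟙 (R v u) + ∑[ u < n ] 𝟙 (R u v))
      ≡⟨ sum-cong-≗ (λ v → ∑-distrib-+ (𝟙 ∘ R v) (λ u → 𝟙 (R u v))) ⟨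
    ∑[ v < n ] ∑[ u < n ] (𝟙 (R v u) + 𝟙 (R u v))
      ≤⟨ ∑-mono-≤ (λ v → ∑-mono-≤ (λ u → 𝟙-disjoint (R⊆H v u) (R⁻¹⊆H v u) (asym v u))) ⟩
    ∑[ v < n ] ∑[ u < n ] 𝟙 (adj H v u)
      ≡⟨ degreeSum≡∑∑ H ⟨
    degreeSum H
      ∎
    where
    open ≤-Reasoning
    ∑R : ℕ
    ∑R = ∑[ v < n ] ∑[ u < n ] 𝟙 (R v u)
    R⁻¹⊆H : ∀ v u → T (R u v) → T (adj H v u)
    R⁻¹⊆H v u t = subst T (Graph.sym H u v) (R⊆H u v t)

module BreadthFirst {m : ℕ} (H : Graph (suc m)) (connected : Connected H) where

  Within : ℕ → Pred (Fin (suc m)) 0ℓ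
  Within zero    v = v ≡ zero
  Within (suc k) v = v ≡ zero ⊎ ∃[ u ] T (adj H v u) × Within k u

  within? : ∀ k → Decidable (Within k)
  within? zero    v = v ≟ zero
  within? (suc k) v = v ≟ zero ⊎-dec any? (λ u → T? (adj H v u) ×-dec within? k u)

  walk⇒within : ∀ {v} → Walk H v zero → ∃[ k ] Within k v
  walk⇒within here = 0 , refl
  walk⇒within (step v~u walk) with walk⇒within walk
  ... | k , u-within = suc k , inj₂ (_ , v~u , u-within)

  level-spec : ∀ v → ∃[ l ] Within l v × (∀ {j} → Within j v → l ≤ j)
  level-spec v = least-witness (λ k → within? k v) (proj₂ (walk⇒within (connected v zero)))

  level : Fin (suc m) → ℕ
  level v = proj₁ (level-spec v)

  level-within : ∀ v → Within (level v) v
  level-within v = proj₁ (proj₂ (level-spec v))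

  level-minimal : ∀ {v j} → Within j v → level v ≤ j
  level-minimal {v} = proj₂ (proj₂ (level-spec v))

  descend : ∀ {v} l → Within l v → v ≢ zero → ∃[ u ] T (adj H v u) × level u < l
  descend zero    v≡0                         v≢0 = contradiction v≡0 v≢0
  descend (suc k) (inj₁ v≡0)                  v≢0 = contradiction v≡0 v≢0
  descend (suc k) (inj₂ (u , v~u , u-within)) _   =
    u , v~u , s≤s (level-minimal u-within)

  parent-step : ∀ v → ∃[ u ] T (adj H (suc v) u) × level u < level (suc v)
  parent-step v = descend (level (suc v)) (level-within (suc v)) λ ()

  parent : Fin m → Fin (suc m)
  parent v = proj₁ (parent-step v)

  ParentEdge : Fin (suc m) → Fin (suc m) → Bool
  ParentEdge zero    u = false
  ParentEdge (suc v) u = does (u ≟ parent v)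

  ParentEdge⇒adj : ∀ v u → T (ParentEdge v u) → T (adj H v u)
  ParentEdge⇒adj (suc v) u t with refl ← T-does-≟ u (parent v) t
    = proj₁ (proj₂ (parent-step v))

  ParentEdge⇒level< : ∀ v u → T (ParentEdge v u) → level u < level v
  ParentEdge⇒level< (suc v) u t with refl ← T-does-≟ u (parent v) t
    = proj₂ (proj₂ (parent-step v))

  ParentEdge-asym : ∀ v u → T (ParentEdge v u) → T (ParentEdge u v) → ⊥
  ParentEdge-asym v u vu uv = <-asym (ParentEdge⇒level< v u vu) (ParentEdge⇒level< u v uv)

  ∑-ParentEdge : ∑[ v < suc m ] ∑[ u < suc m ] 𝟙 (ParentEdge v u) ≡ m
  ∑-ParentEdge = begin
    ∑[ u < suc m ] 0 + ∑[ v < m ] ∑[ u < suc m ] 𝟙 (does (u ≟ parent v))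
      ≡⟨ cong₂ _+_ (sum-replicate-zero (suc m)) (sum-cong-≗ (∑-𝟙-≟ ∘ parent)) ⟩
    ∑[ v < m ] 1
      ≡⟨ ∑-const-1 m ⟩
    m
      ∎
    where open ≡-Reasoning

connected⇒2[n-1]≤degreeSum : ∀ {n} {H : Graph n} → Connected H → 2 * (n ∸ 1) ≤ degreeSum H
connected⇒2[n-1]≤degreeSum {zero}  _ = z≤n
connected⇒2[n-1]≤degreeSum {suc m} {H} connected = begin
  2 * m
    ≡⟨ cong (2 *_) ∑-ParentEdge ⟨
  2 * ∑[ v < suc m ] ∑[ u < suc m ] 𝟙 (ParentEdge v u)
    ≤⟨ 2*asymmetric≤degreeSum H ParentEdge ParentEdge⇒adj ParentEdge-asym ⟩
  degreeSum H
    ∎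
  where
  open ≤-Reasoning
  open BreadthFirst H connected

module _ {n : ℕ} where

  adj⇒≢ : ∀ (H : Graph n) {v w} → T (adj H v w) → v ≢ w
  adj⇒≢ H {v} v~v refl = subst T (irr H v) v~v

  adj⇒1≤deg : ∀ (H : Graph n) {v} w → T (adj H v w) → 1 ≤ deg H v
  adj⇒1≤deg H {v} w v~w =
    subst (1 ≤_) (sym (deg≡∑ H v)) (≤-trans (1≤𝟙 v~w) (∑-point (𝟙 ∘ adj H v) w))

  deg≤1⇒unique-neighbour : ∀ (H : Graph n) {v a b} → deg H v ≤ 1 →
                           T (adj H v a) → T (adj H v b) → a ≡ b
  deg≤1⇒unique-neighbour H {v} {a} {b} deg≤1 v~a v~b with a ≟ b
  ... | yes a≡b = a≡b
  ... | no  a≢b = contradiction (≤-trans 2≤deg deg≤1) 1+n≰n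
    where
    2≤deg : 2 ≤ deg H v
    2≤deg = subst (2 ≤_) (sym (deg≡∑ H v))
                  (≤-trans (+-mono-≤ (1≤𝟙 v~a) (1≤𝟙 v~b)) (∑-pair (𝟙 ∘ adj H v) a≢b))

  connected⇒neighbour : ∀ {H : Graph n} → Connected H → ∀ {v u} → v ≢ u → ∃[ w ] T (adj H v w)
  connected⇒neighbour connected {v} {u} v≢u with connected v u
  ... | here               = contradiction refl v≢u
  ... | step {w = w} v~w _ = w , v~w

  walk-preserves : ∀ {H : Graph n} (S : Pred (Fin n) 0ℓ) →
                   (∀ {v w} → S v → T (adj H v w) → S w) →
                   ∀ {u v} → Walk H u v → S u → S v
  walk-preserves S closed here           Su = Su
  walk-preserves S closed (step u~w walk) Su = walk-preserves S closed walk (closed Su u~w)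

module ConnectedSpanningPair {n : ℕ} (G T₁ T₂ : Graph n)
  (T₁⊆G : T₁ ⊆G G) (T₂⊆G : T₂ ⊆G G)
  (T₁-connected : Connected T₁) (T₂-connected : Connected T₂)
  (shared≤1 : commonEdges T₁ T₂ ≤ 1) where

  Shared : Graph n
  Shared = T₁ ∩G T₂

  degreeSum-shared≤2 : degreeSum Shared ≤ 2
  degreeSum-shared≤2 = begin
    degreeSum Shared        ≡⟨ handshake Shared ⟩
    2 * edgeCount Shared    ≡⟨ cong (2 *_) (commonEdges≡edgeCount T₁ T₂) ⟨
    2 * commonEdges T₁ T₂   ≤⟨ *-monoʳ-≤ 2 shared≤1 ⟩
    2                       ∎
    where open ≤-Reasoning

  4[n-1]-2≤degreeSum : 4 * (n ∸ 1) ∸ 2 ≤ degreeSum G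
  4[n-1]-2≤degreeSum = m≤n+o⇒m∸n≤o (4 * (n ∸ 1)) 2 (begin
    4 * (n ∸ 1)
      ≡⟨ *-distribʳ-+ (n ∸ 1) 2 2 ⟩
    2 * (n ∸ 1) + 2 * (n ∸ 1)
      ≤⟨ +-mono-≤ (connected⇒2[n-1]≤degreeSum T₁-connected)
                  (connected⇒2[n-1]≤degreeSum T₂-connected) ⟩
    degreeSum T₁ + degreeSum T₂
      ≤⟨ degreeSum-inclusion-exclusion {G = G} {T₁} {T₂} T₁⊆G T₂⊆G ⟩
    degreeSum G + degreeSum Shared
      ≤⟨ +-monoʳ-≤ (degreeSum G) degreeSum-shared≤2 ⟩
    degreeSum G + 2
      ≡⟨ +-comm (degreeSum G) 2 ⟩
    2 + degreeSum G
      ∎)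
    where open ≤-Reasoning

  1≤deg : ∀ {v u} → v ≢ u → 1 ≤ deg G v
  1≤deg {v} v≢u with connected⇒neighbour T₁-connected v≢u
  ... | w , v~w = adj⇒1≤deg G w (T₁⊆G v w v~w)

  pendant⇒shared-edge : ∀ {v u} → deg G v ≤ 1 → v ≢ u → ∃[ a ] T (adj Shared v a)
  pendant⇒shared-edge {v} pendant v≢u
    with connected⇒neighbour T₁-connected v≢u | connected⇒neighbour T₂-connected v≢u
  ... | a , v~₁a | b , v~₂b
    with refl ← deg≤1⇒unique-neighbour G pendant (T₁⊆G v a v~₁a) (T₂⊆G v b v~₂b)
    = a , from T-∧ (v~₁a , v~₂b)

  no-two-pendants : ∀ {x y z} → x ≢ y → x ≢ z → y ≢ z → deg G x ≤ 1 → deg G y ≤ 1 → ⊥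
  no-two-pendants {x} {y} {z} x≢y x≢z y≢z x-pendant y-pendant
    with pendant⇒shared-edge x-pendant x≢z | pendant⇒shared-edge y-pendant y≢z
  ... | a , x~a | b , y~b with a ≟ y
  ...   | no a≢y = contradiction (≤-trans 3≤degreeSum-shared degreeSum-shared≤2) 1+n≰n
    where
    a~x : T (adj Shared a x)
    a~x = subst T (Graph.sym Shared x a) x~a
    3≤degreeSum-shared : 3 ≤ degreeSum Shared
    3≤degreeSum-shared =
      ≤-trans (+-mono-≤ (+-mono-≤ (adj⇒1≤deg Shared a x~a) (adj⇒1≤deg Shared b y~b))
                        (adj⇒1≤deg Shared x a~x))
              (∑-triple (deg Shared) x≢y (adj⇒≢ Shared x~a) (a≢y ∘ sym))
  ...   | yes refl =
    [ x≢z ∘ sym , y≢z ∘ sym ]′ (walk-preserves S closed (T₁-connected x z) (inj₁ refl))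
    where
    S : Pred (Fin n) 0ℓ
    S v = v ≡ x ⊎ v ≡ y
    x~y : T (adj G x y)
    x~y = T₁⊆G x y (proj₁ (to T-∧ x~a))
    closed : ∀ {v w} → S v → T (adj T₁ v w) → S w
    closed (inj₁ refl) x~w = inj₂ (deg≤1⇒unique-neighbour G x-pendant (T₁⊆G x _ x~w) x~y)
    closed (inj₂ refl) y~w = inj₁ (deg≤1⇒unique-neighbour G y-pendant (T₁⊆G y _ y~w)
                                     (subst T (Graph.sym G x y) x~y))

lemma3p2 : (n : ℕ) → (n>2 : 2 < n) → (d : Vector ℕ n) → Graphical d →
    Σ (Graph n) (λ G → Realizes G d × Σ (Graph n) (λ T₁ → Σ (Graph n) (λ T₂ →
      SpanningTree G T₁ × SpanningTree G T₂ × commonEdges T₁ T₂ ≤ 1))) →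
    (4 * (n ∸ 1) ∸ 2 ≤ sumV d)
      × (2 ≤ d (fromℕ< {n ∸ 2} (∸-lemma₂ n n>2)))
      × (1 ≤ d (fromℕ< {n ∸ 1} (∸-lemma₁ n n>2)))
lemma3p2 (suc zero) (s≤s ())
lemma3p2 (suc (suc zero)) (s≤s (s≤s ()))
lemma3p2 n@(suc (suc (suc k))) n>2 d (d-nonIncreasing , _)
         (G , G⊨d , T₁ , T₂ , (T₁⊆G , T₁-connected , _) , (T₂⊆G , T₂-connected , _) , shared≤1)
  = subst (4 * (n ∸ 1) ∸ 2 ≤_) (sym (realizes⇒sumV≡degreeSum G G⊨d)) 4[n-1]-2≤degreeSum
  , ≮⇒≥ (λ d[x]<2 → no-two-pendants x≢y x≢0 y≢0 (x-pendant d[x]<2) (y-pendant d[x]<2))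
  , ≤-trans (1≤deg y≢0) (≤-reflexive (G⊨d y))
  where
  open ConnectedSpanningPair G T₁ T₂ T₁⊆G T₂⊆G T₁-connected T₂-connected shared≤1
  x y : Fin n
  x = fromℕ< (∸-lemma₂ n n>2)
  y = fromℕ< (∸-lemma₁ n n>2)
  x≢y : x ≢ y
  x≢y = (λ ()) ∘ fromℕ<-injective (suc k) (suc (suc k)) (∸-lemma₂ n n>2) (∸-lemma₁ n n>2)
  x≢0 : x ≢ zero
  x≢0 = (λ ()) ∘ fromℕ<-injective (suc k) 0 (∸-lemma₂ n n>2) z<s
  y≢0 : y ≢ zero
  y≢0 = (λ ()) ∘ fromℕ<-injective (suc (suc k)) 0 (∸-lemma₁ n n>2) z<s
  x≤y : toℕ x ≤ toℕ y
  x≤y = subst₂ _≤_ (sym (toℕ-fromℕ< (∸-lemma₂ n n>2))) (sym (toℕ-fromℕ< (∸-lemma₁ n n>2)))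
               (n≤1+n (suc k))
  x-pendant : d x < 2 → deg G x ≤ 1
  x-pendant (s≤s d[x]≤1) = subst (_≤ 1) (sym (G⊨d x)) d[x]≤1
  y-pendant : d x < 2 → deg G y ≤ 1
  y-pendant (s≤s d[x]≤1) = subst (_≤ 1) (sym (G⊨d y)) (≤-trans (d-nonIncreasing x y x≤y) d[x]≤1)
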